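{- Let $n\ge 2$, $d\ge1$, $r\ge1$ be integers with $n\ge d$ and $dr\equiv0\pmod n$. For any fixed $\mathbf a\in\mathbb Z_2^n$ and any $j$ with $1\le j\le n$, there are exactly $dr/n$ distinct cube edges of $Q_n(d,r)$ joining a vertex of the $\mathbf a$-ring to a vertex of the form $(\mathbf a+\mathbf e_j,x)$, namely the edges joining $(\mathbf a,x_l)$ and $(\mathbf a+\mathbf e_j,x_l)$, where $x_l=\lfloor (j+ln-1)/d\rfloor$, $0\le l<dr/n$.
   Context: For $1\le i\le n$ let $\mathbf e_i\in\mathbb Z_2^n$ be the $i$-th standard basis row vector, subscripts read modulo $n$. Let $M$ be the $n\times n$ permutation matrix over $\mathbb F_2$ with $\mathbf e_iM=\mathbf e_{i+1}$. Let $G=\mathbb Z_2^n\rtimes\mathbb Z_r$ be the group on $\mathbb Z_2^n\times\mathbb Z_r$ with $(\mathbf a,x)(\mathbf b,y)=(\mathbf a+\mathbf bM^{dx},x+y)$. The recursive cube of rings $Q_n(d,r)$ is the Cayley graph $\mathrm{Cay}(G,S)$ with $S=\{(\mathbf 0_n,1),(\mathbf 0_n,r-1),(\mathbf e_1,0),\dots,(\mathbf e_d,0)\}$; the neighbours of $(\mathbf a,x)$ are $(\mathbf a+\mathbf e_{i+dx},x)$ for $1\le i\le d$ (these are cube edges) and $(\mathbf a,x\pm1)$ (ring edges). The $\mathbf a$-ring is the cycle $(\mathbf a,0),(\mathbf a,1),\dots,(\mathbf a,r-1),(\mathbf a,0)$. Elements of $\mathbb Z_r$ are identified with $\{0,\dots,r-1\}$.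 -}

module Defs where

open import Data.Nat using (ℕ; suc; _+_; _*_; _∸_; _≤_; NonZero; _≡ᵇ_)
open import Data.Nat.DivMod using (_%_)
open import Data.Bool using (Bool; _xor_)
open import Data.Fin using (Fin; toℕ)
open import Data.Vec using (Vec; tabulate; zipWith)
open import Data.Product using (Σ; _×_; _,_)
open import Relation.Binary.PropositionalEquality using (_≡_)

-- Elements of Z_2^n are Boolean vectors of length n; Fin index k stands for
-- coordinate k+1 (coordinates are 1..n as in the paper).
Word : ℕ → Set
Word n = Vec Bool n

_⊕_ : ∀ {n} → Word n → Word n → Word n
_⊕_ = zipWith _xor_

-- e i : the i-th standard basis vector, subscript i read modulo n
-- (coordinate k+1 is 1 iff k+1 ≡ i mod n).
e : (n : ℕ) .{{_ : NonZero n}} → ℕ → Word n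
e n i = tabulate (λ (k : Fin n) → (suc (toℕ k) % n) ≡ᵇ (i % n))

Vertex : ℕ → ℕ → Set
Vertex n r = Word n × Fin r

CubeEdge : (n d r : ℕ) .{{_ : NonZero n}} → Vertex n r → Vertex n r → Set
CubeEdge n d r (a , x) (b , y) =
  (y ≡ x) × Σ ℕ (λ i → (1 ≤ i) × (i ≤ d) × (b ≡ a ⊕ e n (i + d * toℕ x)))

module Submission where

-- A cube edge at ring position x flips coordinate i + d x (mod n) with
-- 1 ≤ i ≤ d, so it reaches a + e_j exactly when j ≡ i + d x (mod n) for some
-- label i in the window 1..d.  The proof separates the two layers:
--   * word level: a ⊕ _ is cancellative and e i determines i mod n, so such an
--     edge is the same thing as a label i with j ≡ i + d x (mod n);
--   * arithmetic: since 1 ≤ j ≤ n, the numbers congruent to j that can be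
--     written as i + d x are j + l n (l ≥ 0), and j + l n = i + d x with
--     1 ≤ i ≤ d says precisely x = ⌊(j + l n - 1)/d⌋.  The positions
--     x_l = ⌊(j + l n - 1)/d⌋ lie in Z_r exactly for l < dr/n (as
--     (dr/n) n = dr), and they are pairwise distinct because consecutive
--     numerators differ by n ≥ d.

open import Defs
open import Data.Nat using (ℕ; zero; suc; _+_; _*_; _∸_; _≤_; _<_; NonZero; _≡ᵇ_; z≤n; s≤s)
open import Data.Nat.Properties
open import Data.Nat.DivMod
  using (_/_; _%_; m≡m%n+[m/n]*n; m%n<n; n%n≡0; m<n⇒m%n≡m; [m+kn]%n≡m%n;
         m*n/n≡m; /-congˡ; /-monoˡ-≤; m<n*o⇒m/o<n; m<n⇒m/n≡0; m/n≡1+[m∸n]/n;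
         +-distrib-/-∣ʳ)
open import Data.Nat.Divisibility using (_∣_; divides; n∣m*n)
open import Data.Bool using (Bool; T; _xor_)
open import Data.Bool.Properties using (xor-assoc; xor-same)
open import Data.Fin using (Fin; toℕ; fromℕ<)
open import Data.Fin.Properties using (toℕ-fromℕ<; toℕ<n)
open import Data.Vec using (Vec; []; _∷_; lookup; tabulate)
open import Data.Vec.Properties using (lookup∘tabulate)
open import Data.Product using (Σ; _×_; _,_)
open import Data.Sum using (inj₁; inj₂)
open import Data.Empty using (⊥-elim)
open import Function.Bundles using (_⇔_; mk⇔; Equivalence)
open import Relation.Binary.Definitions using (tri<; tri≈; tri>)
open import Relation.Binary.PropositionalEquality
  using (_≡_; refl; sym; trans; cong; cong₂; subst; module ≡-Reasoning)

⊕-involutiveˡ : ∀ {n} (a u : Word n) → a ⊕ (a ⊕ u) ≡ u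
⊕-involutiveˡ []      []      = refl
⊕-involutiveˡ (x ∷ a) (y ∷ u) =
  cong₂ _∷_ (trans (sym (xor-assoc x x y)) (cong (_xor y) (xor-same x)))
            (⊕-involutiveˡ a u)

⊕-cancelˡ : ∀ {n} (a u v : Word n) → a ⊕ u ≡ a ⊕ v → u ≡ v
⊕-cancelˡ a u v eq = begin
  u           ≡⟨ sym (⊕-involutiveˡ a u) ⟩
  a ⊕ (a ⊕ u) ≡⟨ cong (a ⊕_) eq ⟩
  a ⊕ (a ⊕ v) ≡⟨ ⊕-involutiveˡ a v ⟩
  v           ∎
  where open ≡-Reasoning

e-coordinate : ∀ n .{{_ : NonZero n}} i (k : Fin n) →
               T (lookup (e n i) k) ⇔ (suc (toℕ k) % n ≡ i % n)
e-coordinate n i k = mk⇔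
  (λ t → ≡ᵇ⇒≡ _ _ (subst T (lookup∘tabulate _ k) t))
  (λ p → subst T (sym (lookup∘tabulate _ k)) (≡⇒≡ᵇ _ _ p))

-- Every residue t < n is the residue of some coordinate k+1 (t = 0 is hit by k+1 = n).
coordinate-with-residue : ∀ n .{{_ : NonZero n}} t → t < n →
                          Σ (Fin n) (λ k → suc (toℕ k) % n ≡ t)
coordinate-with-residue (suc n′) zero _ =
  fromℕ< (n<1+n n′) ,
  trans (cong (λ u → suc u % suc n′) (toℕ-fromℕ< (n<1+n n′))) (n%n≡0 (suc n′))
coordinate-with-residue n (suc t) t<n =
  fromℕ< (<-trans (n<1+n t) t<n) ,
  trans (cong (λ u → suc u % n) (toℕ-fromℕ< (<-trans (n<1+n t) t<n))) (m<n⇒m%n≡m t<n)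

e-cong : ∀ n .{{_ : NonZero n}} i i′ → i % n ≡ i′ % n → e n i ≡ e n i′
e-cong n i i′ p = cong (λ t → tabulate (λ (k : Fin n) → (suc (toℕ k) % n) ≡ᵇ t)) p

e-injective : ∀ n .{{_ : NonZero n}} i i′ → e n i ≡ e n i′ → i % n ≡ i′ % n
e-injective n i i′ p with coordinate-with-residue n (i % n) (m%n<n i n)
... | k , k≡i = trans (sym k≡i) (to (e-coordinate n i′ k) set-in-e-i′)
  where
  open Equivalence
  set-in-e-i′ : T (lookup (e n i′) k)
  set-in-e-i′ = subst (λ w → T (lookup w k)) p (from (e-coordinate n i k) k≡i)

cubeEdge-to-neighbour-ring :
  ∀ n d r .{{_ : NonZero n}} (a : Word n) j (x y : Fin r) →
  CubeEdge n d r (a , x) (a ⊕ e n j , y) ⇔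
  ((y ≡ x) × Σ ℕ (λ i → (1 ≤ i) × (i ≤ d) × (j % n ≡ (i + d * toℕ x) % n)))
cubeEdge-to-neighbour-ring n d r a j x y = mk⇔
  (λ { (y≡x , i , 1≤i , i≤d , eq) →
         y≡x , i , 1≤i , i≤d , e-injective n _ _ (⊕-cancelˡ a _ _ eq) })
  (λ { (y≡x , i , 1≤i , i≤d , j≡) →
         y≡x , i , 1≤i , i≤d , cong (a ⊕_) (e-cong n _ _ j≡) })

floor-window : ∀ d .{{_ : NonZero d}} N X →
               Σ ℕ (λ i → (1 ≤ i) × (i ≤ d) × (i + d * X ≡ suc N)) ⇔ (X ≡ N / d)
floor-window d N X = mk⇔ to from
  where
  open ≡-Reasoning
  to : Σ ℕ (λ i → (1 ≤ i) × (i ≤ d) × (i + d * X ≡ suc N)) → X ≡ N / d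
  to (suc i′ , _ , i′<d , eq) = sym (begin
    N / d                 ≡⟨ /-congˡ (sym (suc-injective eq)) ⟩
    (i′ + d * X) / d      ≡⟨ /-congˡ (cong (i′ +_) (*-comm d X)) ⟩
    (i′ + X * d) / d      ≡⟨ +-distrib-/-∣ʳ i′ (n∣m*n X) ⟩
    i′ / d + X * d / d    ≡⟨ cong₂ _+_ (m<n⇒m/n≡0 i′<d) (m*n/n≡m X d) ⟩
    X                     ∎)
  from : X ≡ N / d → Σ ℕ (λ i → (1 ≤ i) × (i ≤ d) × (i + d * X ≡ suc N))
  from X≡ = suc (N % d) , s≤s z≤n , m%n<n N d , cong suc (begin
    N % d + d * X         ≡⟨ cong (λ t → N % d + d * t) X≡ ⟩
    N % d + d * (N / d)   ≡⟨ cong (N % d +_) (*-comm d (N / d)) ⟩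
    N % d + N / d * d     ≡⟨ sym (m≡m%n+[m/n]*n N d) ⟩
    N                     ∎)

residue-lift : ∀ n .{{_ : NonZero n}} j p → 1 ≤ j → j ≤ n → 1 ≤ p →
               j % n ≡ p % n → Σ ℕ (λ l → j + l * n ≡ p)
residue-lift n j p _ j≤n 1≤p j≡p with m≤n⇒m<n∨m≡n j≤n
... | inj₁ j<n = p / n , (begin
  j + p / n * n         ≡⟨ cong (_+ p / n * n) (trans (sym (m<n⇒m%n≡m j<n)) j≡p) ⟩
  p % n + p / n * n     ≡⟨ sym (m≡m%n+[m/n]*n p n) ⟩
  p                     ∎)
  where open ≡-Reasoning
... | inj₂ refl = positive-multiple (p / n) (begin
  p                     ≡⟨ m≡m%n+[m/n]*n p n ⟩
  p % n + p / n * n     ≡⟨ cong (_+ p / n * n) (trans (sym j≡p) (n%n≡0 n)) ⟩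
  p / n * n             ∎)
  where
  open ≡-Reasoning
  positive-multiple : ∀ q → p ≡ q * n → Σ ℕ (λ l → n + l * n ≡ p)
  positive-multiple zero    p≡0 = ⊥-elim (<⇒≢ 1≤p (sym p≡0))
  positive-multiple (suc l) p≡  = l , sym p≡

label⇔ladder-floor : ∀ n d .{{_ : NonZero n}} .{{_ : NonZero d}} j X → 1 ≤ j → j ≤ n →
  Σ ℕ (λ i → (1 ≤ i) × (i ≤ d) × (j % n ≡ (i + d * X) % n))
  ⇔ Σ ℕ (λ l → X ≡ (j + l * n ∸ 1) / d)
label⇔ladder-floor n d (suc j′) X 1≤j j≤n = mk⇔ to from
  where
  to : Σ ℕ (λ i → (1 ≤ i) × (i ≤ d) × (suc j′ % n ≡ (i + d * X) % n)) →
       Σ ℕ (λ l → X ≡ (j′ + l * n) / d)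
  to (i , 1≤i , i≤d , j≡) with residue-lift n (suc j′) (i + d * X) 1≤j j≤n
                                 (≤-trans 1≤i (m≤m+n i (d * X))) j≡
  ... | l , rung≡ = l , Equivalence.to (floor-window d (j′ + l * n) X)
                          (i , 1≤i , i≤d , sym rung≡)
  from : Σ ℕ (λ l → X ≡ (j′ + l * n) / d) →
         Σ ℕ (λ i → (1 ≤ i) × (i ≤ d) × (suc j′ % n ≡ (i + d * X) % n))
  from (l , X≡) with Equivalence.from (floor-window d (j′ + l * n) X) X≡
  ... | i , 1≤i , i≤d , window≡ =
    i , 1≤i , i≤d ,
    trans (sym ([m+kn]%n≡m%n (suc j′) l n)) (cong (_% n) (sym window≡))

floor<⇔ : ∀ d .{{_ : NonZero d}} N r → (N / d < r) ⇔ (N < r * d)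
floor<⇔ d N r = mk⇔ below (m<n*o⇒m/o<n)
  where
  open ≤-Reasoning
  below : N / d < r → N < r * d
  below q<r = begin-strict
    N                   ≡⟨ m≡m%n+[m/n]*n N d ⟩
    N % d + N / d * d   <⟨ +-monoˡ-< (N / d * d) (m%n<n N d) ⟩
    suc (N / d) * d     ≤⟨ *-monoˡ-≤ d q<r ⟩
    r * d               ∎

rung≤⇔ : ∀ n j l m → 1 ≤ j → j ≤ n → (j + l * n ≤ m * n) ⇔ (l < m)
rung≤⇔ n j l m 1≤j j≤n = mk⇔ to from
  where
  open ≤-Reasoning
  to : j + l * n ≤ m * n → l < m
  to rung≤ = *-cancelʳ-< n l m (begin-strict
    l * n       <⟨ +-monoˡ-≤ (l * n) 1≤j ⟩
    j + l * n   ≤⟨ rung≤ ⟩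
    m * n       ∎)
  from : l < m → j + l * n ≤ m * n
  from l<m = begin
    j + l * n   ≤⟨ +-monoˡ-≤ (l * n) j≤n ⟩
    suc l * n   ≤⟨ *-monoˡ-≤ n l<m ⟩
    m * n       ∎

ladder-floor-in-range : ∀ n d r m .{{_ : NonZero d}} j l → m * n ≡ d * r →
  1 ≤ j → j ≤ n → ((j + l * n ∸ 1) / d < r) ⇔ (l < m)
ladder-floor-in-range n d r m (suc j′) l mn≡dr 1≤j j≤n = mk⇔
  (λ x<r → Equivalence.to (rung≤⇔ n (suc j′) l m 1≤j j≤n)
             (subst (suc j′ + l * n ≤_) (trans (*-comm r d) (sym mn≡dr))
                    (Equivalence.to (floor<⇔ d (j′ + l * n) r) x<r)))
  (λ l<m → Equivalence.from (floor<⇔ d (j′ + l * n) r)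
             (subst (suc j′ + l * n ≤_) (trans mn≡dr (*-comm d r))
                    (Equivalence.from (rung≤⇔ n (suc j′) l m 1≤j j≤n) l<m)))

floor-shift : ∀ d .{{_ : NonZero d}} A B → A + d ≤ B → A / d < B / d
floor-shift d A B A+d≤B = ≤-trans (≤-reflexive (sym floor-step)) (/-monoˡ-≤ d A+d≤B)
  where
  floor-step : (A + d) / d ≡ suc (A / d)
  floor-step = trans (m/n≡1+[m∸n]/n (m≤n+m d A)) (cong (λ u → suc (u / d)) (m+n∸n≡m A d))

ladder-floor-increasing : ∀ n d .{{_ : NonZero d}} c l l′ → d ≤ n → l < l′ →
                          (c + l * n) / d < (c + l′ * n) / d
ladder-floor-increasing n d c l l′ d≤n l<l′ = floor-shift d _ _ (begin
  c + l * n + d       ≤⟨ +-monoʳ-≤ (c + l * n) d≤n ⟩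
  c + l * n + n       ≡⟨ +-assoc c (l * n) n ⟩
  c + (l * n + n)     ≡⟨ cong (c +_) (+-comm (l * n) n) ⟩
  c + suc l * n       ≤⟨ +-monoʳ-≤ c (*-monoˡ-≤ n l<l′) ⟩
  c + l′ * n          ∎)
  where open ≤-Reasoning

ladder-floor-injective : ∀ n d .{{_ : NonZero d}} j l l′ → 1 ≤ j → d ≤ n →
                         (j + l * n ∸ 1) / d ≡ (j + l′ * n ∸ 1) / d → l ≡ l′
ladder-floor-injective n d (suc j′) l l′ _ d≤n eq with <-cmp l l′
... | tri< l<l′ _ _ = ⊥-elim (<-irrefl eq (ladder-floor-increasing n d j′ l l′ d≤n l<l′))
... | tri≈ _ l≡l′ _ = l≡l′
... | tri> _ _ l′<l = ⊥-elim (<-irrefl (sym eq) (ladder-floor-increasing n d j′ l′ l d≤n l′<l))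

lemma2p4 : (n d r : ℕ) .{{_ : NonZero n}} .{{_ : NonZero d}} →
    2 ≤ n → 1 ≤ d → 1 ≤ r → d ≤ n → n ∣ d * r →
    (a : Vec Bool n) (j : ℕ) → 1 ≤ j → j ≤ n →
    ((∀ l → l < (d * r) / n → (j + l * n ∸ 1) / d < r)
     × (∀ l l′ → l < (d * r) / n → l′ < (d * r) / n →
          (j + l * n ∸ 1) / d ≡ (j + l′ * n ∸ 1) / d → l ≡ l′)
     × (∀ (x y : Fin r) →
          CubeEdge n d r (a , x) (a ⊕ e n j , y)
          ⇔ Σ ℕ (λ l → (l < (d * r) / n) × (toℕ x ≡ (j + l * n ∸ 1) / d) × (y ≡ x))))
lemma2p4 n d r _ _ _ d≤n (divides m dr≡mn) a j 1≤j j≤n =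
  (λ l l<dr/n → from (in-range l) (subst (l <_) dr/n≡m l<dr/n)) ,
  (λ l l′ _ _ → ladder-floor-injective n d j l l′ 1≤j d≤n) ,
  (λ x y → mk⇔ (edge→ladder x y) (ladder→edge x y))
  where
  open Equivalence
  dr/n≡m : (d * r) / n ≡ m
  dr/n≡m = trans (/-congˡ dr≡mn) (m*n/n≡m m n)
  in-range : ∀ l → ((j + l * n ∸ 1) / d < r) ⇔ (l < m)
  in-range l = ladder-floor-in-range n d r m j l (sym dr≡mn) 1≤j j≤n
  edge→ladder : ∀ (x y : Fin r) → CubeEdge n d r (a , x) (a ⊕ e n j , y) →
    Σ ℕ (λ l → (l < (d * r) / n) × (toℕ x ≡ (j + l * n ∸ 1) / d) × (y ≡ x))
  edge→ladder x y edge with to (cubeEdge-to-neighbour-ring n d r a j x y) edge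
  ... | y≡x , label with to (label⇔ladder-floor n d j (toℕ x) 1≤j j≤n) label
  ... | l , x≡ = l , subst (l <_) (sym dr/n≡m) (to (in-range l) (subst (_< r) x≡ (toℕ<n x)))
                   , x≡ , y≡x
  ladder→edge : ∀ (x y : Fin r) →
    Σ ℕ (λ l → (l < (d * r) / n) × (toℕ x ≡ (j + l * n ∸ 1) / d) × (y ≡ x)) →
    CubeEdge n d r (a , x) (a ⊕ e n j , y)
  ladder→edge x y (l , _ , x≡ , y≡x) =
    from (cubeEdge-to-neighbour-ring n d r a j x y)
         (y≡x , from (label⇔ladder-floor n d j (toℕ x) 1≤j j≤n) (l , x≡))
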